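{- Let $R$ be an infinite ribbon and let $\lambda/\mu$ be a skew shape compatible with $R$ with ending tuple $\bar a=(a_1,\dots,a_n)$ and starting tuple $\bar b=(b_1,\dots,b_n)$. Let $I\subseteq[n]$. Then the $I\times I$ principal submatrix of the ribbon decomposition matrix $A_{\lambda/\mu,R}$ equals $A_{\lambda'/\mu',R}$, where $\lambda'/\mu'$ is a skew shape compatible with $R$ whose ending and starting tuples are $(a_i\mid i\in I)$ and $(b_i\mid i\in I)$ respectively (obtained from $\lambda/\mu$ by contracting the ribbons $\theta_r$, $r\notin I$).
   Context: Cells of $\mathbb{Z}^2$ are indexed $(i,j)$ with $i$ increasing downward and $j$ increasing rightward; the content of $(i,j)$ is $j-i$. A ribbon is a connected skew shape containing no $2\times 2$ block. An infinite ribbon $R$ is a ribbon with an extra infinite horizontal ($1\times\infty$) or vertical ($\infty\times 1$) block attached at its beginning and at its end; it contains exactly one cell $r_c$ of each content $c\in\mathbb{Z}$, and $r_c$ lies immediately to the right of or immediately above $r_{c-1}$. For integers $a\le b$, $[a,b)_R$ denotes the set of cells $r_c$ with $a\le c<b$, and $s_{[a,b)_R}$ its skew Schur function. The plane is tiled by the copies (diagonal translates) of $R$. A skew shape $\lambda/\mu$ is compatible with $R$ if its intersection with each copy of $R$ is contiguous. Listing the nonempty intersections of $\lambda/\mu$ with copies of $R$ from inside out (northwest to southeast) as $\theta_1,\dots,\theta_n$, each $\theta_k$ is a copy of $[a_k,b_k)_R$ with $a_k<b_k$; $\bar a=(a_1,\dots,a_n)$ is the ending tuple and $\bar b=(b_1,\dots,b_n)$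 the starting tuple. The ribbon decomposition matrix is $A_{\lambda/\mu,R}=\big(s_{[a_j,b_i)_R}\big)_{i,j=1}^n$, with $s_{[a_j,b_i)_R}=1$ if $a_j=b_i$ and $=0$ if $a_j>b_i$. -}

module Defs where

open import Data.Bool using (Bool; true; false; _∧_; if_then_else_)
open import Data.Nat as ℕ using (ℕ; zero; suc)
open import Data.Integer as ℤ using (ℤ; +_; _-_)
import Data.Integer.Properties as ℤP
import Data.Nat.Properties as ℕP
open import Data.Fin as Fin using (Fin)
open import Data.List as List using (List; []; _∷_; map; upTo; concatMap; length; filter; filterᵇ)
open import Data.Bool.ListAction using (all)
open import Data.List.Relation.Unary.Linked using (Linked)
open import Data.Product using (_×_; _,_; proj₁; proj₂; Σ; ∃; ∃-syntax)
open import Data.Product.Properties using (≡-dec)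
open import Data.Sum using (_⊎_)
open import Relation.Binary.PropositionalEquality using (_≡_)
open import Relation.Nullary.Decidable using (⌊_⌋)
open import Function.Bundles using (_⇔_)

-- Cells of ℤ²: (i , j), i increasing downward, j increasing rightward.

Cell : Set
Cell = ℤ × ℤ

content : Cell → ℤ
content (i , j) = j - i

rightOf : Cell → Cell
rightOf (i , j) = (i , j ℤ.+ ℤ.1ℤ)

above : Cell → Cell
above (i , j) = (i - ℤ.1ℤ , j)

below : Cell → Cell
below (i , j) = (i ℤ.+ ℤ.1ℤ , j)

record InfRibbon : Set where
  field
    r        : ℤ → Cell
    r-content : ∀ c → content (r c) ≡ c
    r-step   : ∀ c → (r (c ℤ.+ ℤ.1ℤ) ≡ rightOf (r c)) ⊎ (r (c ℤ.+ ℤ.1ℤ) ≡ above (r c))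
    r-end    : ∃[ N ] ((∀ c → N ℤ.≤ c → r (c ℤ.+ ℤ.1ℤ) ≡ rightOf (r c))
                      ⊎ (∀ c → N ℤ.≤ c → r (c ℤ.+ ℤ.1ℤ) ≡ above (r c)))
    r-begin  : ∃[ N ] ((∀ c → c ℤ.≤ N → r (c ℤ.+ ℤ.1ℤ) ≡ rightOf (r c))
                      ⊎ (∀ c → c ℤ.≤ N → r (c ℤ.+ ℤ.1ℤ) ≡ above (r c)))
open InfRibbon public

copyCell : InfRibbon → ℤ → ℤ → Cell
copyCell R k c with r R c
... | (i , j) = (i ℤ.+ k , j ℤ.+ k)

-- Partitions and skew shapes (cells 0-indexed; contents unaffected).

IsPartition : List ℕ → Set
IsPartition = Linked ℕ._≥_

part : List ℕ → ℕ → ℕ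
part []       _       = 0
part (x ∷ _)  zero    = x
part (_ ∷ xs) (suc i) = part xs i

IsSkewShape : List ℕ → List ℕ → Set
IsSkewShape λ' μ = IsPartition λ' × IsPartition μ × (∀ i → part μ i ℕ.≤ part λ' i)

_∈Skew_/_ : Cell → List ℕ → List ℕ → Set
x ∈Skew λ' / μ = ∃[ i ] ∃[ j ] (x ≡ (+ i , + j) × part μ i ℕ.≤ j × j ℕ.< part λ' i)

-- λ/μ is compatible with R with ending tuple a and starting tuple b:
-- there are copies k₁ < … < kₙ of R such that the intersection of λ/μ with
-- copy kₜ is exactly the copy of [aₜ , bₜ)_R (with aₜ < bₜ), and λ/μ misses
-- every other copy. (Copies are listed NW to SE, i.e. by increasing k.)

HasTuples : InfRibbon → List ℕ → List ℕ → (n : ℕ) → (Fin n → ℤ) → (Fin n → ℤ) → Set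
HasTuples R λ' μ n a b =
  Σ (Fin n → ℤ) λ k →
    (∀ s t → s Fin.< t → k s ℤ.< k t) ×
    (∀ t → a t ℤ.< b t) ×
    (∀ (kk c : ℤ) → (copyCell R kk c ∈Skew λ' / μ)
                    ⇔ (∃[ t ] (kk ≡ k t × a t ℤ.≤ c × c ℤ.< b t)))

CompatibleWith : InfRibbon → List ℕ → List ℕ → Set
CompatibleWith R λ' μ = ∃[ n ] ∃[ a ] ∃[ b ] HasTuples R λ' μ n a b

-- Symmetric functions, represented by their monomial coefficients:
-- F α = coefficient of x₁^{α₁} ⋯ x_ℓ^{α_ℓ}, where ℓ = length α.

SymF : Set
SymF = List ℕ → ℕ

_≈F_ : SymF → SymF → Set
F ≈F G = ∀ α → F α ≡ G α

oneF : SymF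
oneF α = if all (λ v → ⌊ v ℕ.≟ 0 ⌋) α then 1 else 0

zeroF : SymF
zeroF _ = 0

allFillings : ℕ → ℕ → List (List ℕ)
allFillings zero    ℓ = [] ∷ []
allFillings (suc m) ℓ = concatMap (λ v → map (v ∷_) (allFillings m ℓ)) (upTo ℓ)

zipL : {A B : Set} → List A → List B → List (A × B)
zipL (x ∷ xs) (y ∷ ys) = (x , y) ∷ zipL xs ys
zipL _ _ = []

_≟C_ : (x y : Cell) → _
_≟C_ = ≡-dec ℤ._≟_ ℤ._≟_

isSSYT : List (Cell × ℕ) → Bool
isSSYT T = all (λ p → all (λ q → ok p q) T) T
  where
  ok : Cell × ℕ → Cell × ℕ → Bool
  ok (x , v) (y , w) =
    (if ⌊ y ≟C rightOf x ⌋ then ⌊ v ℕ.≤? w ⌋ else true) ∧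
    (if ⌊ y ≟C below x ⌋ then ⌊ v ℕ.<? w ⌋ else true)

hasContent : List ℕ → List ℕ → Bool
hasContent vals α =
  all (λ (v , m) → ⌊ length (filter (λ u → u ℕ.≟ v) vals) ℕ.≟ m ⌋)
           (zipL (upTo (length α)) α)

schurCells : List Cell → SymF
schurCells cs α =
  length (filterᵇ (λ vals → isSSYT (zipL cs vals) ∧ hasContent vals α)
                  (allFillings (length cs) (length α)))

ribbonCells : InfRibbon → ℤ → ℤ → List Cell
ribbonCells R a b = map (λ t → r R (a ℤ.+ + t)) (upTo ℤ.∣ b - a ∣)

sRib : InfRibbon → ℤ → ℤ → SymF
sRib R a b with a ℤ.<? b | a ℤ.≟ b
... | Relation.Nullary.Decidable.yes _ | _ = schurCells (ribbonCells R a b)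
... | Relation.Nullary.Decidable.no _  | Relation.Nullary.Decidable.yes _ = oneF
... | Relation.Nullary.Decidable.no _  | Relation.Nullary.Decidable.no _ = zeroF

decompMatrix : InfRibbon → (n : ℕ) → (Fin n → ℤ) → (Fin n → ℤ) → Fin n → Fin n → SymF
decompMatrix R n a b i j = sRib R (a j) (b i)

-- It suffices to delete one ribbon θ_p and then induct on the number of ribbons outside I.
-- To delete θ_p, keep the copies of R beyond it and push every copy inside it one step
-- southeast onto the next copy, overwriting θ_p.  The copy index of a cell is monotone in
-- the componentwise order, so the resulting set of cells is again order-convex; it lies in
-- ℕ², and a finite order-convex subset of ℕ² is a skew shape.  Its intersections with the
-- copies of R are the θ_t (t ≠ p), so the ending and starting tuples just lose their p-th
-- entries.  The decomposition matrix depends only on these tuples, which gives the claim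
-- about principal submatrices.

module Submission where

open import Defs
open import Data.Nat as ℕ using (ℕ; zero; suc; z≤n; s≤s)
import Data.Nat.Properties as ℕₚ
open import Data.Integer using (ℤ; +_; -[1+_]; _+_; _-_; -_; _≤_; _<_; +≤+; 1ℤ; ∣_∣)
open import Data.Integer.Properties
open import Data.Integer.Tactic.RingSolver using (solve-∀)
open import Data.Fin as Fin using (Fin; punchIn; punchOut)
import Data.Fin.Properties as Finₚ
open import Data.List using (List; []; _∷_; length; applyUpTo)
open import Data.List.Relation.Unary.Linked as Linked using ([]; [-]; _∷_)
open import Data.Product using (_×_; _,_; proj₁; proj₂; map₂; ∃-syntax)
open import Data.Product.Function.NonDependent.Propositional using (_×-⇔_)
open import Data.Sum using (_⊎_; inj₁; inj₂)
open import Data.Sum.Function.Propositional using (_⊎-⇔_)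
open import Data.Empty using (⊥-elim)
open import Function using (_∘_)
open import Function.Bundles using (_⇔_; mk⇔; Equivalence)
open import Function.Properties.Equivalence using () renaming (refl to ⇔-refl; trans to ⇔-trans)
open import Relation.Nullary using (Dec; yes; no; ¬_)
open import Relation.Nullary.Decidable using (map′; _×-dec_; _⊎-dec_; ¬?; decidable-stable)
open import Relation.Binary.PropositionalEquality
open import Relation.Binary.Definitions using (tri<; tri≈; tri>)

_≼_ : Cell → Cell → Set
(i , j) ≼ (i′ , j′) = i ≤ i′ × j ≤ j′

≼-refl : ∀ {x} → x ≼ x
≼-refl = ≤-refl , ≤-refl

≼-trans : ∀ {x y z} → x ≼ y → y ≼ z → x ≼ z
≼-trans (p , q) (p′ , q′) = ≤-trans p p′ , ≤-trans q q′

OrderConvex : (Cell → Set) → Set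
OrderConvex Q = ∀ {x y z} → Q x → Q y → x ≼ z → z ≼ y → Q z

northwest : Cell → Cell
northwest (i , j) = (i - 1ℤ , j - 1ℤ)

northwest-≼ : ∀ x → northwest x ≼ x
northwest-≼ (i , j) = i-j≤i i 1ℤ , i-j≤i j 1ℤ

northwest-mono : ∀ {x y} → x ≼ y → northwest x ≼ northwest y
northwest-mono (p , q) = +-monoˡ-≤ (- 1ℤ) p , +-monoˡ-≤ (- 1ℤ) q

-- Geometry of an infinite ribbon and of its copies

step-monotone : (f : ℤ → ℤ) → (∀ c → f c ≤ f (c + 1ℤ)) → ∀ {c c′} → c ≤ c′ → f c ≤ f c′
step-monotone f step {c} {c′} c≤c′ = subst (λ e → f c ≤ f e) c+∣c-c′∣≡c′ (monotone-offset c ∣ c - c′ ∣)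
  where
  monotone-offset : ∀ c d → f c ≤ f (c + + d)
  monotone-offset c zero    = ≤-reflexive (cong f (sym (+-identityʳ c)))
  monotone-offset c (suc d) =
    ≤-trans (step c) (subst (λ e → f (c + 1ℤ) ≤ f e) (+-assoc c 1ℤ (+ d)) (monotone-offset (c + 1ℤ) d))

  i+[j-i]≡j : ∀ i j → i + (j - i) ≡ j
  i+[j-i]≡j = solve-∀

  c+∣c-c′∣≡c′ : c + + ∣ c - c′ ∣ ≡ c′
  c+∣c-c′∣≡c′ = trans (cong (λ e → c + e) (∣-∣-≤ c≤c′)) (i+[j-i]≡j c c′)

module _ (R : InfRibbon) where

  row col : ℤ → ℤ
  row c = proj₁ (r R c)
  col c = proj₂ (r R c)

  row-step : ∀ c → row (c + 1ℤ) ≤ row c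
  row-step c with r-step R c
  ... | inj₁ right = ≤-reflexive (cong proj₁ right)
  ... | inj₂ up    = ≤-trans (≤-reflexive (cong proj₁ up)) (i-j≤i (row c) 1ℤ)

  col-step : ∀ c → col c ≤ col (c + 1ℤ)
  col-step c with r-step R c
  ... | inj₁ right = ≤-trans (i≤i+j (col c) 1ℤ) (≤-reflexive (sym (cong proj₂ right)))
  ... | inj₂ up    = ≤-reflexive (sym (cong proj₂ up))

  row-antitone : ∀ {c c′} → c ≤ c′ → row c′ ≤ row c
  row-antitone = neg-cancel-≤ ∘ step-monotone (-_ ∘ row) (neg-mono-≤ ∘ row-step)

  col-monotone : ∀ {c c′} → c ≤ c′ → col c ≤ col c′
  col-monotone = step-monotone col col-step

  -- Copy k of R has its cell of content c in row (row c + k).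
  copyIndex : Cell → ℤ
  copyIndex (i , j) = i - row (j - i)

  copyIndex-by-col : ∀ x → copyIndex x ≡ proj₂ x - col (content x)
  copyIndex-by-col (i , j) = begin
    i - row (j - i)                                 ≡⟨ i-ρ≡j-[[j-i]+ρ] i j (row (j - i)) ⟩
    j - ((j - i) + row (j - i))                     ≡⟨ cong (λ e → j - (e + row (j - i))) (sym (r-content R (j - i))) ⟩
    j - ((col (j - i) - row (j - i)) + row (j - i)) ≡⟨ cong (λ e → j - e) ([γ-ρ]+ρ≡γ (col (j - i)) (row (j - i))) ⟩
    j - col (j - i)                                 ∎
    where
    open ≡-Reasoning
    i-ρ≡j-[[j-i]+ρ] : ∀ i j ρ → i - ρ ≡ j - ((j - i) + ρ)
    i-ρ≡j-[[j-i]+ρ] = solve-∀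
    [γ-ρ]+ρ≡γ : ∀ γ ρ → (γ - ρ) + ρ ≡ γ
    [γ-ρ]+ρ≡γ = solve-∀

  -- Rows of R weakly rise and columns weakly advance as the content grows,
  -- so compare rows when the content grows from x to y and columns otherwise.
  copyIndex-monotone : ∀ {x y} → x ≼ y → copyIndex x ≤ copyIndex y
  copyIndex-monotone {x} {y} (i≤i′ , j≤j′) with ≤-total (content x) (content y)
  ... | inj₁ cx≤cy = +-mono-≤ i≤i′ (neg-mono-≤ (row-antitone cx≤cy))
  ... | inj₂ cy≤cx = subst₂ _≤_ (sym (copyIndex-by-col x)) (sym (copyIndex-by-col y))
                            (+-mono-≤ j≤j′ (neg-mono-≤ (col-monotone cy≤cx)))

  content-copyCell : ∀ k c → content (copyCell R k c) ≡ c
  content-copyCell k c = trans ([γ+k]-[ρ+k]≡γ-ρ (col c) (row c) k) (r-content R c)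
    where
    [γ+k]-[ρ+k]≡γ-ρ : ∀ γ ρ k → (γ + k) - (ρ + k) ≡ γ - ρ
    [γ+k]-[ρ+k]≡γ-ρ = solve-∀

  copyIndex-copyCell : ∀ k c → copyIndex (copyCell R k c) ≡ k
  copyIndex-copyCell k c = begin
    (row c + k) - row (content (copyCell R k c)) ≡⟨ cong (λ e → (row c + k) - row e) (content-copyCell k c) ⟩
    (row c + k) - row c                          ≡⟨ [ρ+k]-ρ≡k (row c) k ⟩
    k                                            ∎
    where
    open ≡-Reasoning
    [ρ+k]-ρ≡k : ∀ ρ k → (ρ + k) - ρ ≡ k
    [ρ+k]-ρ≡k = solve-∀

  northwest-copyCell : ∀ k c → northwest (copyCell R k c) ≡ copyCell R (k - 1ℤ) c
  northwest-copyCell k c = cong₂ _,_ ([e+k]-1≡e+[k-1] (row c) k) ([e+k]-1≡e+[k-1] (col c) k)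
    where
    [e+k]-1≡e+[k-1] : ∀ e k → (e + k) - 1ℤ ≡ e + (k - 1ℤ)
    [e+k]-1≡e+[k-1] = solve-∀

InBox : ℕ → ℕ → Cell → Set
InBox H W x = ∃[ i ] ∃[ j ] (x ≡ (+ i , + j) × i ℕ.< H × j ℕ.< W)

part-head : ∀ {x l} → IsPartition (x ∷ l) → part l 0 ℕ.≤ x
part-head {l = []}    _ = z≤n
part-head {l = _ ∷ _} p = Linked.head p

part-antitone : ∀ {l} → IsPartition l → ∀ {i i′} → i ℕ.≤ i′ → part l i′ ℕ.≤ part l i
part-antitone {[]}    _ _ = z≤n
part-antitone {_ ∷ _} p {zero}  {zero}  _         = ℕₚ.≤-refl
part-antitone {_ ∷ _} p {zero}  {suc _} _         = ℕₚ.≤-trans (part-antitone (Linked.tail p) z≤n) (part-head p)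
part-antitone {_ ∷ _} p {suc _} {suc _} (s≤s i≤i′) = part-antitone (Linked.tail p) i≤i′

part-nonzero⇒<length : ∀ l i {j} → j ℕ.< part l i → i ℕ.< length l
part-nonzero⇒<length (_ ∷ _) zero    _ = s≤s z≤n
part-nonzero⇒<length (_ ∷ l) (suc i) j<part = s≤s (part-nonzero⇒<length l i j<part)

skew? : ∀ λ′ μ x → Dec (x ∈Skew λ′ / μ)
skew? λ′ μ (+ i , + j) = map′ (λ (μi≤j , j<λi) → i , j , refl , μi≤j , j<λi)
                       (λ { (_ , _ , refl , μi≤j , j<λi) → μi≤j , j<λi })
                       (part μ i ℕₚ.≤? j ×-dec j ℕₚ.<? part λ′ i)
skew? _ _ (+ _ , -[1+ _ ]) = no λ { (_ , _ , () , _) }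
skew? _ _ (-[1+ _ ] , _)   = no λ { (_ , _ , () , _) }

skew-bounded : ∀ {λ′} μ → IsPartition λ′ → ∀ {x} → x ∈Skew λ′ / μ → InBox (length λ′) (part λ′ 0) x
skew-bounded {λ′} _ λ-part (i , j , x≡ , _ , j<λi) =
  i , j , x≡ , part-nonzero⇒<length λ′ i j<λi , ℕₚ.<-≤-trans j<λi (part-antitone λ-part z≤n)

skew-convex : ∀ {λ′ μ} → IsSkewShape λ′ μ → OrderConvex (_∈Skew λ′ / μ)
skew-convex (λ-part , μ-part , _) (_ , _ , refl , μi≤j , _) (_ , _ , refl , _ , j′<λi′)
            (+≤+ i≤i″ , +≤+ j≤j″) (+≤+ i″≤i′ , +≤+ j″≤j′) =
  _ , _ , refl ,
  ℕₚ.≤-trans (part-antitone μ-part i≤i″) (ℕₚ.≤-trans μi≤j j≤j″) ,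
  ℕₚ.≤-<-trans j″≤j′ (ℕₚ.<-≤-trans j′<λi′ (part-antitone λ-part i″≤i′))

-- Finite order-convex subsets of ℕ² are skew shapes

-- For Q closed downwards: the length of the initial segment of [0, w) on which Q holds.
prefixLength : ∀ {Q : ℕ → Set} → (∀ j → Dec (Q j)) → ℕ → ℕ
prefixLength Q? zero = zero
prefixLength Q? (suc w) with Q? w
... | yes _ = suc w
... | no  _ = prefixLength Q? w

module _ {Q : ℕ → Set} (Q? : ∀ j → Dec (Q j)) where

  <prefixLength : ∀ w {j} → Q j → j ℕ.< w → j ℕ.< prefixLength Q? w
  <prefixLength (suc w) {j} Qj j<1+w with Q? w
  ... | yes _ = j<1+w
  ... | no ¬Qw with ℕₚ.m≤n⇒m<n∨m≡n (ℕₚ.<⇒≤pred j<1+w)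
  ...   | inj₁ j<w  = <prefixLength w Qj j<w
  ...   | inj₂ refl = ⊥-elim (¬Qw Qj)

module _ {Q : ℕ → Set} (Q? : ∀ j → Dec (Q j)) (Q-down : ∀ {j j′} → j′ ℕ.≤ j → Q j → Q j′) where

  <prefixLength⇒ : ∀ w {j} → j ℕ.< prefixLength Q? w → Q j × j ℕ.< w
  <prefixLength⇒ (suc w) j<ℓ with Q? w
  ... | yes Qw = Q-down (ℕₚ.<⇒≤pred j<ℓ) Qw , j<ℓ
  ... | no  _  = map₂ ℕₚ.m<n⇒m<1+n (<prefixLength⇒ w j<ℓ)

  prefixLength-mono : ∀ {Q′ : ℕ → Set} (Q′? : ∀ j → Dec (Q′ j)) → (∀ {j} → Q j → Q′ j) →
                    ∀ w → prefixLength Q? w ℕ.≤ prefixLength Q′? w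
  prefixLength-mono Q′? Q⊆Q′ w = ℕₚ.≮⇒≥ λ ℓ′<ℓ →
    let (Qℓ′ , ℓ′<w) = <prefixLength⇒ w ℓ′<ℓ
    in ℕₚ.<-irrefl refl (<prefixLength Q′? w (Q⊆Q′ Qℓ′) ℓ′<w)

part-applyUpTo : ∀ (f : ℕ → ℕ) H → (∀ i → H ℕ.≤ i → f i ≡ 0) → ∀ i → part (applyUpTo f H) i ≡ f i
part-applyUpTo f zero    f-vanishes i       = sym (f-vanishes i z≤n)
part-applyUpTo f (suc H) f-vanishes zero    = refl
part-applyUpTo f (suc H) f-vanishes (suc i) = part-applyUpTo (f ∘ suc) H (λ i H≤i → f-vanishes (suc i) (s≤s H≤i)) i

applyUpTo-partition : ∀ (f : ℕ → ℕ) → (∀ i → f (suc i) ℕ.≤ f i) → ∀ H → IsPartition (applyUpTo f H)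
applyUpTo-partition f f-anti zero          = []
applyUpTo-partition f f-anti (suc zero)    = [-]
applyUpTo-partition f f-anti (suc (suc H)) = f-anti 0 ∷ applyUpTo-partition (f ∘ suc) (f-anti ∘ suc) (suc H)

module _ (Q : Cell → Set) (Q? : ∀ x → Dec (Q x)) {H W : ℕ}
         (Q-bounded : ∀ {x} → Q x → InBox H W x) (Q-convex : OrderConvex Q) where

  private
    P : ℕ → ℕ → Set
    P i j = Q (+ i , + j)

    P-bounded : ∀ {i j} → P i j → i ℕ.< H × j ℕ.< W
    P-bounded Pij with Q-bounded Pij
    ... | _ , _ , refl , i<H , j<W = i<H , j<W

    -- The skew shape is Covered / Gap: Covered is the order ideal generated by P,
    -- and convexity of P is what makes Gap = Covered ∖ P an order ideal too.
    Covered : ℕ → ℕ → Set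
    Covered i j = ∃[ i′ ] ∃[ j′ ] (i ℕ.≤ i′ × j ℕ.≤ j′ × P i′ j′)

    Gap : ℕ → ℕ → Set
    Gap i j = Covered i j × ¬ P i j

    Covered? : ∀ i j → Dec (Covered i j)
    Covered? i j = map′ (λ (i′ , _ , j′ , _ , Pi′j′) → i′ , j′ , Pi′j′)
                        (λ (i′ , j′ , i≤i′ , j≤j′ , Pi′j′) →
                           let (i′<H , j′<W) = P-bounded Pi′j′ in i′ , i′<H , j′ , j′<W , i≤i′ , j≤j′ , Pi′j′)
                        (ℕₚ.anyUpTo? (λ i′ → ℕₚ.anyUpTo? (λ j′ →
                           i ℕₚ.≤? i′ ×-dec j ℕₚ.≤? j′ ×-dec Q? (+ i′ , + j′)) W) H)

    Gap? : ∀ i j → Dec (Gap i j)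
    Gap? i j = Covered? i j ×-dec ¬? (Q? (+ i , + j))

    Covered-down : ∀ {i j i₀ j₀} → i₀ ℕ.≤ i → j₀ ℕ.≤ j → Covered i j → Covered i₀ j₀
    Covered-down i₀≤i j₀≤j (i′ , j′ , i≤i′ , j≤j′ , P′) =
      i′ , j′ , ℕₚ.≤-trans i₀≤i i≤i′ , ℕₚ.≤-trans j₀≤j j≤j′ , P′

    Gap-down : ∀ {i j i₀ j₀} → i₀ ℕ.≤ i → j₀ ℕ.≤ j → Gap i j → Gap i₀ j₀
    Gap-down i₀≤i j₀≤j (cov@(_ , _ , i≤i′ , j≤j′ , P′) , ¬Pij) =
      Covered-down i₀≤i j₀≤j cov ,
      λ P₀ → ¬Pij (Q-convex P₀ P′ (+≤+ i₀≤i , +≤+ j₀≤j) (+≤+ i≤i′ , +≤+ j≤j′))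

    Covered⇒<W : ∀ {i j} → Covered i j → j ℕ.< W
    Covered⇒<W (_ , _ , _ , j≤j′ , P′) = ℕₚ.≤-<-trans j≤j′ (proj₂ (P-bounded P′))

    λ-row μ-row : ℕ → ℕ
    λ-row i = prefixLength (Covered? i) W
    μ-row i = prefixLength (Gap? i) W

    <λ-row⇔ : ∀ {i j} → j ℕ.< λ-row i ⇔ Covered i j
    <λ-row⇔ {i} = mk⇔ (proj₁ ∘ <prefixLength⇒ (Covered? i) (Covered-down ℕₚ.≤-refl) W)
                      (λ cov → <prefixLength (Covered? i) W cov (Covered⇒<W cov))

    <μ-row⇔ : ∀ {i j} → j ℕ.< μ-row i ⇔ Gap i j
    <μ-row⇔ {i} = mk⇔ (proj₁ ∘ <prefixLength⇒ (Gap? i) (Gap-down ℕₚ.≤-refl) W)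
                      (λ gap → <prefixLength (Gap? i) W gap (Covered⇒<W (proj₁ gap)))

    λ-row-vanishes : ∀ i → H ℕ.≤ i → λ-row i ≡ 0
    λ-row-vanishes i H≤i with λ-row i in eq
    ... | zero  = refl
    ... | suc _ with Equivalence.to <λ-row⇔ (subst (0 ℕ.<_) (sym eq) (s≤s z≤n))
    ...   | _ , _ , i≤i′ , _ , P′ =
      ⊥-elim (ℕₚ.<-irrefl refl (ℕₚ.<-≤-trans (proj₁ (P-bounded P′)) (ℕₚ.≤-trans H≤i i≤i′)))

    μ-row≤λ-row : ∀ i → μ-row i ℕ.≤ λ-row i
    μ-row≤λ-row i = prefixLength-mono (Gap? i) (Gap-down ℕₚ.≤-refl) (Covered? i) proj₁ W

    μ-row-vanishes : ∀ i → H ℕ.≤ i → μ-row i ≡ 0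
    μ-row-vanishes i H≤i = ℕₚ.n≤0⇒n≡0 (subst (μ-row i ℕ.≤_) (λ-row-vanishes i H≤i) (μ-row≤λ-row i))

    λ-row-antitone : ∀ i → λ-row (suc i) ℕ.≤ λ-row i
    λ-row-antitone i =
      prefixLength-mono (Covered? (suc i)) (Covered-down ℕₚ.≤-refl)
                        (Covered? i) (Covered-down (ℕₚ.n≤1+n i) ℕₚ.≤-refl) W

    μ-row-antitone : ∀ i → μ-row (suc i) ℕ.≤ μ-row i
    μ-row-antitone i =
      prefixLength-mono (Gap? (suc i)) (Gap-down ℕₚ.≤-refl)
                        (Gap? i) (Gap-down (ℕₚ.n≤1+n i) ℕₚ.≤-refl) W

    λ″ μ″ : List ℕ
    λ″ = applyUpTo λ-row H
    μ″ = applyUpTo μ-row H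

    part-λ″ : ∀ i → part λ″ i ≡ λ-row i
    part-λ″ = part-applyUpTo λ-row H λ-row-vanishes

    part-μ″ : ∀ i → part μ″ i ≡ μ-row i
    part-μ″ = part-applyUpTo μ-row H μ-row-vanishes

    ∈Skew⇔P : ∀ {i j} → (part μ″ i ℕ.≤ j × j ℕ.< part λ″ i) ⇔ P i j
    ∈Skew⇔P {i} {j} rewrite part-λ″ i | part-μ″ i = mk⇔ to from
      where
      to : μ-row i ℕ.≤ j × j ℕ.< λ-row i → P i j
      to (μi≤j , j<λi) with Q? (+ i , + j)
      ... | yes Pij = Pij
      ... | no ¬Pij = ⊥-elim (ℕₚ.<⇒≱ (Equivalence.from <μ-row⇔ (Equivalence.to <λ-row⇔ j<λi , ¬Pij)) μi≤j)
      from : P i j → μ-row i ℕ.≤ j × j ℕ.< λ-row i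
      from Pij = ℕₚ.≮⇒≥ (λ j<μi → proj₂ (Equivalence.to <μ-row⇔ j<μi) Pij) ,
                 Equivalence.from <λ-row⇔ (i , j , ℕₚ.≤-refl , ℕₚ.≤-refl , Pij)

  convex⇒skewShape : ∃[ λ′ ] ∃[ μ ] (IsSkewShape λ′ μ × (∀ x → x ∈Skew λ′ / μ ⇔ Q x))
  convex⇒skewShape =
    λ″ , μ″ ,
    (applyUpTo-partition λ-row λ-row-antitone H , applyUpTo-partition μ-row μ-row-antitone H ,
     λ i → subst₂ ℕ._≤_ (sym (part-μ″ i)) (sym (part-λ″ i)) (μ-row≤λ-row i)) ,
    λ x → mk⇔ (λ { (i , j , refl , μi≤j , j<λi) → Equivalence.to ∈Skew⇔P (μi≤j , j<λi) })
              (λ Qx → let (i , j , x≡ , _) = Q-bounded Qx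
                          (μi≤j , j<λi) = Equivalence.from ∈Skew⇔P (subst Q x≡ Qx)
                      in i , j , x≡ , μi≤j , j<λi)

StrictlyIncreasing : ∀ {n} → (Fin n → ℤ) → Set
StrictlyIncreasing k = ∀ s t → s Fin.< t → k s < k t

i+1≤j⇒i<j : ∀ {i j} → i + 1ℤ ≤ j → i < j
i+1≤j⇒i<j {i} i+1≤j = suc[i]≤j⇒i<j (subst (_≤ _) (+-comm i 1ℤ) i+1≤j)

i≡[i-1]+1 : ∀ i → i ≡ (i - 1ℤ) + 1ℤ
i≡[i-1]+1 = solve-∀

[i+1]-1≡i : ∀ i → (i + 1ℤ) - 1ℤ ≡ i
[i+1]-1≡i = solve-∀

i<j⇒i+1≤j : ∀ {i j} → i < j → i + 1ℤ ≤ j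
i<j⇒i+1≤j {i} i<j = subst (_≤ _) (+-comm 1ℤ i) (i<j⇒suc[i]≤j i<j)

punchIn-mono-< : ∀ {n} (p : Fin (suc n)) {s t : Fin n} → s Fin.< t → punchIn p s Fin.< punchIn p t
punchIn-mono-< p {s} {t} s<t = ℕₚ.≰⇒> λ t≤s → ℕₚ.<⇒≱ s<t (Finₚ.punchIn-cancel-≤ p t s t≤s)

≮∧≢⇒> : ∀ {n} {s p : Fin n} → ¬ s Fin.< p → s ≢ p → p Fin.< s
≮∧≢⇒> s≮p s≢p = ℕₚ.≤∧≢⇒< (ℕₚ.≮⇒≥ s≮p) (s≢p ∘ sym ∘ Finₚ.toℕ-injective)

strictlyIncreasing-reflects-< : ∀ {n} {k : Fin n → ℤ} → StrictlyIncreasing k → ∀ {s t} → k s < k t → s Fin.< t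
strictlyIncreasing-reflects-< {k = k} k-inc {s} {t} ks<kt with Finₚ.<-cmp s t
... | tri< s<t _ _  = s<t
... | tri≈ _ refl _ = ⊥-elim (<-irrefl refl ks<kt)
... | tri> _ _ t<s  = ⊥-elim (<-asym ks<kt (k-inc t s t<s))

module Deletion {n} (k : Fin (suc n) → ℤ) (k-inc : StrictlyIncreasing k) (p : Fin (suc n)) where

  k-reflects-< : ∀ {s t} → k s < k t → s Fin.< t
  k-reflects-< = strictlyIncreasing-reflects-< k-inc

  shifted : Fin (suc n) → ℤ
  shifted s with s Fin.<? p
  ... | yes _ = k s + 1ℤ
  ... | no  _ = k s

  shifted-< : ∀ {s} → s Fin.< p → shifted s ≡ k s + 1ℤ
  shifted-< {s} s<p with s Fin.<? p
  ... | yes _   = refl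
  ... | no s≮p = ⊥-elim (s≮p s<p)

  shifted-≮ : ∀ {s} → ¬ s Fin.< p → shifted s ≡ k s
  shifted-≮ {s} s≮p with s Fin.<? p
  ... | yes s<p = ⊥-elim (s≮p s<p)
  ... | no  _   = refl

  shifted-inc : ∀ {s t} → s Fin.< t → t ≢ p → shifted s < shifted t
  shifted-inc {s} {t} s<t t≢p with s Fin.<? p | t Fin.<? p
  ... | yes _   | yes _   = +-monoˡ-< 1ℤ (k-inc s t s<t)
  ... | yes s<p | no  t≮p = ≤-<-trans (i<j⇒i+1≤j (k-inc s p s<p)) (k-inc p t (≮∧≢⇒> t≮p t≢p))
  ... | no  s≮p | yes t<p = ⊥-elim (s≮p (ℕₚ.<-trans s<t t<p))
  ... | no  _   | no  _   = k-inc s t s<t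

  deleted : Fin n → ℤ
  deleted = shifted ∘ punchIn p

  deleted-inc : StrictlyIncreasing deleted
  deleted-inc s t s<t = shifted-inc (punchIn-mono-< p s<t) (Finₚ.punchInᵢ≢i p t)

  deleted-copies : ∀ kk (A : Fin (suc n) → Set) →
                   ((kk ≤ k p × ∃[ s ] (kk - 1ℤ ≡ k s × A s)) ⊎ (k p < kk × ∃[ s ] (kk ≡ k s × A s)))
                   ⇔ (∃[ t ] (kk ≡ deleted t × A (punchIn p t)))
  deleted-copies kk A = mk⇔ to from
    where
    Before After : Set
    Before = (kk ≤ k p × ∃[ s ] (kk - 1ℤ ≡ k s × A s)) ⊎ (k p < kk × ∃[ s ] (kk ≡ k s × A s))
    After  = ∃[ t ] (kk ≡ deleted t × A (punchIn p t))

    reindex : ∀ {s} → (p≢s : p ≢ s) → kk ≡ shifted s → A s → After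
    reindex p≢s kk≡ As = punchOut p≢s ,
                         trans kk≡ (cong shifted (sym (Finₚ.punchIn-punchOut p≢s))) ,
                         subst A (sym (Finₚ.punchIn-punchOut p≢s)) As

    to : Before → After
    to (inj₁ (kk≤kp , s , kk-1≡ks , As)) =
      reindex (λ p≡s → <-irrefl (cong k (sym p≡s)) ks<kp)
              (trans kk≡ks+1 (sym (shifted-< (k-reflects-< ks<kp)))) As
      where
      kk≡ks+1 : kk ≡ k s + 1ℤ
      kk≡ks+1 = trans (i≡[i-1]+1 kk) (cong (_+ 1ℤ) kk-1≡ks)
      ks<kp : k s < k p
      ks<kp = i+1≤j⇒i<j (subst (_≤ k p) kk≡ks+1 kk≤kp)
    to (inj₂ (kp<kk , s , kk≡ks , As)) =
      reindex (λ p≡s → <-irrefl (cong k p≡s) kp<ks)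
              (trans kk≡ks (sym (shifted-≮ (ℕₚ.<⇒≯ p<s)))) As
      where
      kp<ks : k p < k s
      kp<ks = subst (k p <_) kk≡ks kp<kk
      p<s : p Fin.< s
      p<s = k-reflects-< kp<ks

    -- The with-abstraction also evaluates shifted in kk≡ : kk ≡ deleted t.
    from : After → Before
    from (t , kk≡ , As) with punchIn p t Fin.<? p
    ... | yes s<p = inj₁ (subst (_≤ k p) (sym kk≡) (i<j⇒i+1≤j (k-inc _ p s<p)) ,
                          punchIn p t , trans (cong (_- 1ℤ) kk≡) ([i+1]-1≡i _) , As)
    ... | no  s≮p = inj₂ (subst (k p <_) (sym kk≡) (k-inc p _ (≮∧≢⇒> s≮p (Finₚ.punchInᵢ≢i p t))) ,
                          punchIn p t , kk≡ , As)

-- Contracting one ribbon of a compatible skew shape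

module RibbonContraction
  (R : InfRibbon) {λ′ μ : List ℕ} (shape : IsSkewShape λ′ μ) {n : ℕ} {a b : Fin (suc n) → ℤ}
  (k : Fin (suc n) → ℤ) (k-inc : StrictlyIncreasing k) (a<b : ∀ t → a t < b t)
  (copies : ∀ kk c → (copyCell R kk c ∈Skew λ′ / μ) ⇔ (∃[ t ] (kk ≡ k t × a t ≤ c × c < b t)))
  (p : Fin (suc n)) where

  open Deletion k k-inc p

  private
    S : Cell → Set
    S x = x ∈Skew λ′ / μ

    -- Pushing the inner copies outward, rather than pulling the outer ones inward,
    -- keeps all cells in ℕ².
    Contracted : Cell → Set
    Contracted x = (copyIndex R x ≤ k p × S (northwest x)) ⊎ (k p < copyIndex R x × S x)

    Contracted? : ∀ x → Dec (Contracted x)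
    Contracted? x = (copyIndex R x ≤? k p ×-dec skew? λ′ μ (northwest x))
             ⊎-dec (k p <? copyIndex R x ×-dec skew? λ′ μ x)

    Contracted-inner : ∀ {x} → Contracted x → copyIndex R x ≤ k p → S (northwest x)
    Contracted-inner (inj₁ (_ , S-nw))  _      = S-nw
    Contracted-inner (inj₂ (kp<κ , _)) κ≤kp = ⊥-elim (<⇒≱ kp<κ κ≤kp)

    Contracted-outer : ∀ {x} → Contracted x → k p < copyIndex R x → S x
    Contracted-outer (inj₁ (κ≤kp , _)) kp<κ = ⊥-elim (<⇒≱ kp<κ κ≤kp)
    Contracted-outer (inj₂ (_ , Sx))    _    = Sx

    Contracted-lower : ∀ {x} → Contracted x → ∃[ u ] (S u × u ≼ x)
    Contracted-lower {x} (inj₁ (_ , S-nw)) = northwest x , S-nw , northwest-≼ x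
    Contracted-lower {x} (inj₂ (_ , Sx))   = x , Sx , ≼-refl

    Contracted-upper : ∀ {x} → Contracted x → ∃[ u ] (S u × northwest x ≼ u)
    Contracted-upper {x} (inj₁ (_ , S-nw)) = northwest x , S-nw , ≼-refl
    Contracted-upper {x} (inj₂ (_ , Sx))   = x , Sx , northwest-≼ x

    Contracted-convex : OrderConvex Contracted
    Contracted-convex {x} {y} {z} Qx Qy x≼z z≼y with copyIndex R z ≤? k p
    ... | yes κz≤kp =
      let (u , Su , nw-y≼u) = Contracted-upper Qy
          S-nw-x = Contracted-inner Qx (≤-trans (copyIndex-monotone R x≼z) κz≤kp)
      in inj₁ (κz≤kp , skew-convex shape S-nw-x Su (northwest-mono x≼z) (≼-trans (northwest-mono z≼y) nw-y≼u))
    ... | no κz≰kp =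
      let kp<κz = ≰⇒> κz≰kp
          (u , Su , u≼x) = Contracted-lower Qx
          Sy = Contracted-outer Qy (<-≤-trans kp<κz (copyIndex-monotone R z≼y))
      in inj₂ (kp<κz , skew-convex shape Su Sy (≼-trans u≼x x≼z) z≼y)

    Contracted-bounded : ∀ {x} → Contracted x → InBox (suc (length λ′)) (suc (part λ′ 0)) x
    Contracted-bounded (inj₁ (_ , S-nw)) with skew-bounded μ (proj₁ shape) S-nw
    ... | i , j , nw≡ , i<H , j<W =
      suc i , suc j , cong₂ _,_ (unshift (cong proj₁ nw≡)) (unshift (cong proj₂ nw≡)) , s≤s i<H , s≤s j<W
      where
      unshift : ∀ {e e′} → e - 1ℤ ≡ e′ → e ≡ 1ℤ + e′
      unshift {e} refl = e≡1+[e-1] e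
        where
        e≡1+[e-1] : ∀ e → e ≡ 1ℤ + (e - 1ℤ)
        e≡1+[e-1] = solve-∀
    Contracted-bounded (inj₂ (_ , Sx)) with skew-bounded μ (proj₁ shape) Sx
    ... | i , j , x≡ , i<H , j<W = i , j , x≡ , ℕₚ.m<n⇒m<1+n i<H , ℕₚ.m<n⇒m<1+n j<W

    Contracted-copy : ∀ kk c → Contracted (copyCell R kk c)
                               ⇔ (∃[ t ] (kk ≡ deleted t × a (punchIn p t) ≤ c × c < b (punchIn p t)))
    Contracted-copy kk c =
      ⇔-trans (subst₂ (λ κ y → Contracted (copyCell R kk c) ⇔ ((κ ≤ k p × S y) ⊎ (k p < κ × S (copyCell R kk c))))
                      (copyIndex-copyCell R kk c) (northwest-copyCell R kk c) ⇔-refl)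
      (⇔-trans ((⇔-refl ×-⇔ copies (kk - 1ℤ) c) ⊎-⇔ (⇔-refl ×-⇔ copies kk c))
               (deleted-copies kk (λ s → a s ≤ c × c < b s)))

  contractRibbon : ∃[ λ″ ] ∃[ μ″ ] (IsSkewShape λ″ μ″ × HasTuples R λ″ μ″ n (a ∘ punchIn p) (b ∘ punchIn p))
  contractRibbon with convex⇒skewShape Contracted Contracted? Contracted-bounded Contracted-convex
  ... | λ″ , μ″ , shape″ , ∈⇔Contracted =
    λ″ , μ″ , shape″ , deleted , deleted-inc , a<b ∘ punchIn p ,
    λ kk c → ⇔-trans (∈⇔Contracted (copyCell R kk c)) (Contracted-copy kk c)

HasTuples-cong : ∀ R λ′ μ {m} {a b a′ b′ : Fin m → ℤ} → a ≗ a′ → b ≗ b′ →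
                 HasTuples R λ′ μ m a b → HasTuples R λ′ μ m a′ b′
HasTuples-cong _ _ _ {m} a≗a′ b≗b′ (k , k-inc , a<b , copies) =
  k , k-inc , (λ t → subst₂ _<_ (a≗a′ t) (b≗b′ t) (a<b t)) ,
  λ kk c → ⇔-trans (copies kk c) (mk⇔ (retuple k a≗a′ b≗b′) (retuple k (sym ∘ a≗a′) (sym ∘ b≗b′)))
  where
  retuple : ∀ {kk c} (k : Fin m → ℤ) {a b a′ b′ : Fin m → ℤ} → a ≗ a′ → b ≗ b′ →
            ∃[ t ] (kk ≡ k t × a t ≤ c × c < b t) → ∃[ t ] (kk ≡ k t × a′ t ≤ c × c < b′ t)
  retuple {c = c} _ a≗a′ b≗b′ (t , kk≡ , a≤c , c<b) =
    t , kk≡ , subst (_≤ c) (a≗a′ t) a≤c , subst (c <_) (b≗b′ t) c<b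

HasTuples-reindex : ∀ R λ′ μ {m n} {a b : Fin n → ℤ} (ι : Fin m → Fin n) →
                    (∀ s t → s Fin.< t → ι s Fin.< ι t) → (∀ t → ∃[ s ] ι s ≡ t) →
                    HasTuples R λ′ μ n a b → HasTuples R λ′ μ m (a ∘ ι) (b ∘ ι)
HasTuples-reindex _ _ _ {a = a} {b} ι ι-inc ι-onto (k , k-inc , a<b , copies) =
  k ∘ ι , (λ s t → k-inc (ι s) (ι t) ∘ ι-inc s t) , a<b ∘ ι ,
  λ kk c → ⇔-trans (copies kk c)
             (mk⇔ (λ (t , in-t) → let (s , ιs≡t) = ι-onto t
                                  in s , subst (λ u → kk ≡ k u × a u ≤ c × c < b u) (sym ιs≡t) in-t)
                  (λ (s , in-ιs) → ι s , in-ιs))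

missing-or-onto : ∀ {m n} (ι : Fin m → Fin n) → (∃[ p ] ∀ s → ι s ≢ p) ⊎ (∀ t → ∃[ s ] ι s ≡ t)
missing-or-onto ι with Finₚ.any? (λ p → Finₚ.all? (λ s → ¬? (ι s Finₚ.≟ p)))
... | yes missing = inj₁ missing
... | no ¬missing = inj₂ λ t → decidable-stable (Finₚ.any? (λ s → ι s Finₚ.≟ t))
                                 (λ ¬hit → ¬missing (t , λ s ιs≡t → ¬hit (s , ιs≡t)))

module _ {m n} {p : Fin (suc n)} (ι : Fin m → Fin (suc n)) (p∉ι : ∀ s → ι s ≢ p) where

  avoiding : Fin m → Fin n
  avoiding s = punchOut (p∉ι s ∘ sym)

  avoiding-inc : (∀ s t → s Fin.< t → ι s Fin.< ι t) → ∀ s t → s Fin.< t → avoiding s Fin.< avoiding t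
  avoiding-inc ι-inc s t s<t =
    ℕₚ.≰⇒> λ t≤s → ℕₚ.<⇒≱ (ι-inc s t s<t) (Finₚ.punchOut-cancel-≤ (p∉ι t ∘ sym) (p∉ι s ∘ sym) t≤s)

  punchIn-avoiding : ∀ s → punchIn p (avoiding s) ≡ ι s
  punchIn-avoiding s = Finₚ.punchIn-punchOut (p∉ι s ∘ sym)

restrict : ∀ (R : InfRibbon) {λ′ μ n} {a b : Fin n → ℤ} → IsSkewShape λ′ μ → HasTuples R λ′ μ n a b →
           ∀ {m} (ι : Fin m → Fin n) → (∀ s t → s Fin.< t → ι s Fin.< ι t) →
           ∃[ λ″ ] ∃[ μ″ ] (IsSkewShape λ″ μ″ × HasTuples R λ″ μ″ m (a ∘ ι) (b ∘ ι))
restrict R shape tuples ι ι-inc with missing-or-onto ι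
restrict R {n = zero} shape tuples ι ι-inc | inj₁ (() , _)
restrict R {n = suc _} {a} {b} shape (k , k-inc , a<b , copies) ι ι-inc | inj₁ (p , p∉ι) =
  let (_ , _ , shape″ , tuples″) = RibbonContraction.contractRibbon R shape k k-inc a<b copies p
      (λ‴ , μ‴ , shape‴ , tuples‴) = restrict R shape″ tuples″ (avoiding ι p∉ι) (avoiding-inc ι p∉ι ι-inc)
  in λ‴ , μ‴ , shape‴ ,
     HasTuples-cong R λ‴ μ‴ (cong a ∘ punchIn-avoiding ι p∉ι) (cong b ∘ punchIn-avoiding ι p∉ι) tuples‴
restrict R {λ′} {μ} shape tuples ι ι-inc | inj₂ ι-onto =
  λ′ , μ , shape , HasTuples-reindex R λ′ μ ι ι-inc ι-onto tuples

proposition2p5 :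
    (R : InfRibbon) (λ' μ : List ℕ) → IsSkewShape λ' μ →
    (n : ℕ) (a b : Fin n → ℤ) → HasTuples R λ' μ n a b →
    -- a subset I ⊆ [n], listed increasingly as ι : Fin m → Fin n
    (m : ℕ) (ι : Fin m → Fin n) → (∀ s t → s Fin.< t → ι s Fin.< ι t) →
    ∃[ λ'' ] ∃[ μ' ]
      (IsSkewShape λ'' μ' ×
       HasTuples R λ'' μ' m (a ∘ ι) (b ∘ ι) ×
       (∀ i j → decompMatrix R n a b (ι i) (ι j) ≈F decompMatrix R m (a ∘ ι) (b ∘ ι) i j))
proposition2p5 R λ′ μ shape n a b tuples m ι ι-inc =
  let (λ″ , μ″ , shape″ , tuples″) = restrict R shape tuples ι ι-inc
  in λ″ , μ″ , shape″ , tuples″ , λ _ _ _ → refl
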